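{- Let $\lambda$ be a partition and $c=(x,y)\in\overline{\lambda}$ with $x>\lambda_1$ and $y>\lambda'_1$. Then for every $\nu\in\mathcal{U}(\lambda)$, $$P_{(q,t)}(\nu\mid c)=t^{n(\nu)-n(\lambda)}\,\alpha_{\nu/\lambda}(q,t).$$ In particular $P_{(q,t)}(\nu\mid c)$ does not depend on such $c$.
   Context: Partitions are identified with their Young diagrams in French convention: $\lambda$ is the set of cells $(x,y)\in\mathbb{Z}_{>0}^2$ with $x\le\lambda_y$ (with $\lambda_j=0$ beyond its length); $\lambda'$ is the conjugate (with $\lambda'_i=0$ for $i>\lambda_1$). For $c=(x,y)\in\lambda$: $a_\lambda(c)=\lambda_y-x$, $\ell_\lambda(c)=\lambda'_x-y$; $n(\lambda)=\sum_{c\in\lambda}\ell_\lambda(c)$. $\mathcal{U}(\lambda)$ is the set of partitions $\nu\supseteq\lambda$ with $\nu/\lambda$ a single cell (an outer corner of $\lambda$); $\mathcal{R}_{\nu/\lambda}$ (resp. $\mathcal{C}_{\nu/\lambda}$) is the set of cells of $\lambda$ in the same row (resp. column) as $\nu/\lambda$. With $[i,j]=1-q^it^j$, $$\alpha_{\nu/\lambda}(q,t)=\prod_{c\in\mathcal{R}_{\nu/\lambda}}\frac{[a_\lambda(c),\ell_\lambda(c)+1]}{[a_\nu(c),\ell_\nu(c)+1]}\prod_{c\in\mathcal{C}_{\nu/\lambda}}\frac{[a_\lambda(c)+1,\ell_\lambda(c)]}{[a_\nu(c)+1,\ell_\nu(c)]}.$$ Exterior hook walk: $\overline{\lambda}=\mathbb{Z}_{>0}^2\setminus\lambda$.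 For $c=(x,y)\in\overline{\lambda}$, ${\rm arm}_\lambda(c)=\{(i,y):\lambda_y<i<x\}$, ${\rm leg}_\lambda(c)=\{(x,j):\lambda'_x<j<y\}$, $a_\lambda(c)=|{\rm arm}_\lambda(c)|$, $\ell_\lambda(c)=|{\rm leg}_\lambda(c)|$; $c$ is an outer corner of $\lambda$ iff both are empty. For $c'\in{\rm arm}_\lambda(c)\cup{\rm leg}_\lambda(c)$ set $$P(c\to c')=\begin{cases}q^{a(c)-i}\dfrac{t^{\ell(c)}(1-q)}{1-q^{a(c)}t^{\ell(c)}}&c'=(x-i,y)\in{\rm arm}_\lambda(c),\\[2mm] t^{j-1}\dfrac{1-t}{1-q^{a(c)}t^{\ell(c)}}&c'=(x,y-j)\in{\rm leg}_\lambda(c),\end{cases}$$ with $a=a_\lambda$, $\ell=\ell_\lambda$. The exterior $(q,t)$-hook walk from $c$ stops if $c$ is an outer corner, and otherwise moves to $c'$ with probability $P(c\to c')$ and repeats. $P_{(q,t)}(\nu\mid c)$ is the probability that it terminates at the outer corner $\nu/\lambda$, i.e. the sum over all sequences $c=c_0,c_1,\dots,c_m=\nu/\lambda$ with $c_{k+1}\in{\rm arm}_\lambda(c_k)\cup{\rm leg}_\lambda(c_k)$ and $c_0,\dots,c_{m-1}$ not outer corners, of $\prod_k P(c_k\to c_{k+1})$. -}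

module Defs where

open import Data.Nat as ℕ using (ℕ; zero; suc; _∸_; _≤_; _<_; _≤?_; _≟_)
open import Data.List using (List; []; _∷_; length; filter)
open import Data.List.Relation.Unary.All using (All)
open import Data.Bool using (Bool; true; false; if_then_else_; _∧_)
open import Data.Product using (_×_)
open import Relation.Nullary using (yes; no; ¬_)
open import Relation.Nullary.Decidable using (⌊_⌋)
open import Relation.Binary.PropositionalEquality using (_≡_; _≢_)
open import Data.Rational as ℚ using (ℚ; 0ℚ; 1ℚ; _+_; _*_; _-_; _÷_; ≢-nonZero)
import Data.Rational.Properties as ℚP

-- Partitions as lists of parts (French convention, rows indexed from 1)

-- λ_y  (1-indexed; 0 beyond the length, and 0 at the unused index 0)
row : List ℕ → ℕ → ℕ
row []       _             = 0
row (k ∷ ks) zero          = 0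
row (k ∷ ks) (suc zero)    = k
row (k ∷ ks) (suc (suc y)) = row ks (suc y)

-- λ'_x = number of parts ≥ x  (used for x ≥ 1)
col : List ℕ → ℕ → ℕ
col l x = length (filter (x ≤?_) l)

IsPartition : List ℕ → Set
IsPartition l = All (λ k → 0 < k) l × (∀ y → row l (suc (suc y)) ≤ row l (suc y))

-- ν = λ ∪ {(i , j)} : ν/λ is the single cell (i , j)
AddsCell : List ℕ → List ℕ → ℕ → ℕ → Set
AddsCell lam nu i j =
  (1 ≤ j) × (row nu j ≡ suc (row lam j)) × (i ≡ row nu j) ×
  (∀ y → y ≢ j → row nu y ≡ row lam y)

pow : ℚ → ℕ → ℚ
pow p zero    = 1ℚ
pow p (suc n) = p * pow p n

-- total division (returns 0 on a zero denominator; only used where the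
-- denominators are nonzero under the genericity hypothesis)
div : ℚ → ℚ → ℚ
div p r with r ℚP.≟ 0ℚ
... | yes _ = 0ℚ
... | no ne = _÷_ p r {{≢-nonZero ne}}

br : ℚ → ℚ → ℕ → ℕ → ℚ
br q t i j = 1ℚ - pow q i * pow t j

sum1 : ℕ → (ℕ → ℚ) → ℚ
sum1 zero    f = 0ℚ
sum1 (suc n) f = sum1 n f + f (suc n)

prod1 : ℕ → (ℕ → ℚ) → ℚ
prod1 zero    f = 1ℚ
prod1 (suc n) f = prod1 n f * f (suc n)

Σℕ1 : ℕ → (ℕ → ℕ) → ℕ
Σℕ1 zero    f = 0
Σℕ1 (suc n) f = Σℕ1 n f ℕ.+ f (suc n)

Generic : ℚ → ℚ → Set
Generic q t = ∀ a b → ¬ (a ℕ.+ b ≡ 0) → br q t a b ≢ 0ℚ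

-- n(λ) = Σ_{c ∈ λ} ℓ_λ(c),  cells (x , y) with 1 ≤ y ≤ length λ, 1 ≤ x ≤ λ_y

nFun : List ℕ → ℕ
nFun l = Σℕ1 (length l) (λ y → Σℕ1 (row l y) (λ x → col l x ∸ y))

armIn legIn : List ℕ → ℕ → ℕ → ℕ
armIn l x y = row l y ∸ x
legIn l x y = col l x ∸ y

alpha : List ℕ → List ℕ → ℕ → ℕ → ℚ → ℚ → ℚ
alpha lam nu i j q t =
  prod1 (row lam j) (λ x →
     div (br q t (armIn lam x j) (suc (legIn lam x j)))
         (br q t (armIn nu  x j) (suc (legIn nu  x j))))
  * prod1 (col lam i) (λ y →
     div (br q t (suc (armIn lam i y)) (legIn lam i y))
         (br q t (suc (armIn nu  i y)) (legIn nu  i y)))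

extArm extLeg : List ℕ → ℕ → ℕ → ℕ
extArm l x y = x ∸ row l y ∸ 1
extLeg l x y = y ∸ col l x ∸ 1

isZero : ℕ → Bool
isZero zero    = true
isZero (suc _) = false

eqCell : ℕ → ℕ → ℕ → ℕ → Bool
eqCell x y i j = ⌊ x ≟ i ⌋ ∧ ⌊ y ≟ j ⌋

-- walk lam q t fuel x y i j : probability that the exterior walk started
-- at (x , y) terminates at the outer corner (i , j); this is the sum over
-- all walk sequences, organised by first step.  Each step decreases x + y,
-- so fuel x + y suffices (fuel is never exhausted).
walk : List ℕ → ℚ → ℚ → ℕ → ℕ → ℕ → ℕ → ℕ → ℚ
walk lam q t zero x y i j = 0ℚ
walk lam q t (suc n) x y i j with extArm lam x y | extLeg lam x y
... | a | l =
  if isZero a ∧ isZero l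
  then (if eqCell x y i j then 1ℚ else 0ℚ)
  else
    sum1 a (λ k →
      div (pow q (a ∸ k) * pow t l * (1ℚ - q)) (br q t a l)
        * walk lam q t n (x ∸ k) y i j)
    + sum1 l (λ k →
      div (pow t (k ∸ 1) * (1ℚ - t)) (br q t a l)
        * walk lam q t n x (y ∸ k) i j)

hookProb : List ℕ → ℚ → ℚ → ℕ → ℕ → ℕ → ℕ → ℚ
hookProb lam q t x y i j = walk lam q t (x ℕ.+ y) x y i j

-- Let (i , j) = (λ_j + 1 , j) be the added cell. From (i + d , j + e) the exterior arm and leg
-- are d + p and e + m, with p = λ_j − λ_{j+e} and m = (j − 1) − λ'_{i+d}, and a walk that leaves
-- the quadrant {x ≥ i , y ≥ j} never reaches (i , j). So the absorption probability is a weight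
-- of d times a weight of e: by q^p t^e [d , m] + [p , e] = [d + p , e + m] the first-step
-- equation splits into a recurrence for the d-weight (arm steps) and one for the e-weight (leg
-- steps), both solved by products of ratios of brackets. Beyond λ_1 and λ'_1, where m = j − 1 and p = λ_j, these products
-- telescope to the row and column factors of α_{ν/λ}; and n(ν) − n(λ) = j − 1 since the new cell
-- lengthens by one the legs of the j − 1 cells below it.

module Submission where

open import Defs
open import Algebra.Core using (Op₂)
open import Algebra.Structures using (IsMonoid)
open import Data.Bool using (true; false; if_then_else_; _∧_)
import Data.Bool.Properties as BoolP
open import Data.List using (List; []; _∷_; length)
open import Data.List.Properties using (filter-accept; filter-reject; length-filter)
open import Data.Nat as ℕ using (ℕ; zero; suc; pred; _∸_; _≤_; _<_; _>_; z≤n; s≤s; _≟_)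
import Data.Nat.Properties as ℕP
import Data.Nat.Solver as ℕSolver
open import Data.Product using (_,_)
open import Data.Rational as ℚ using (ℚ; 0ℚ; 1ℚ; _+_; _*_; _-_; ≢-nonZero)
import Data.Rational.Properties as ℚP
import Data.Rational.Solver as ℚSolver
open import Data.Sum using (_⊎_; inj₁; inj₂)
import Data.Sum as Sum
open import Relation.Binary.PropositionalEquality
open import Relation.Nullary using (yes; no; ¬_)
open import Relation.Nullary.Negation using (contradiction)

suc-∸ : ∀ {m n} → n ≤ m → suc m ∸ n ≡ suc (m ∸ n)
suc-∸ n≤m = ℕP.+-∸-assoc 1 n≤m

exterior-gap : ∀ {r u} d → u ≤ r → suc r ℕ.+ d ∸ u ∸ 1 ≡ d ℕ.+ (r ∸ u)
exterior-gap {r} {u} d u≤r = begin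
  suc r ℕ.+ d ∸ u ∸ 1       ≡⟨ cong (_∸ 1) (ℕP.+-∸-comm d (ℕP.m≤n⇒m≤1+n u≤r)) ⟩
  (suc r ∸ u) ℕ.+ d ∸ 1     ≡⟨ cong (λ z → z ℕ.+ d ∸ 1) (suc-∸ u≤r) ⟩
  (r ∸ u) ℕ.+ d             ≡⟨ ℕP.+-comm (r ∸ u) d ⟩
  d ℕ.+ (r ∸ u)             ∎
  where open ≡-Reasoning

∸-pred : ∀ {m n} → 1 ≤ n → n ≤ m → m ∸ pred n ≡ suc (m ∸ n)
∸-pred {suc m} {suc n} _ (s≤s n≤m) = suc-∸ n≤m

∸-shrinks : ∀ {m k} → 1 ≤ k → suc m ∸ k < suc m
∸-shrinks {m} {suc k} _ = s≤s (ℕP.m∸n≤m m k)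

inv : ℚ → ℚ
inv r = div 1ℚ r

div≡*inv : ∀ p r → div p r ≡ p * inv r
div≡*inv p r with r ℚP.≟ 0ℚ
... | yes _ = sym (ℚP.*-zeroʳ p)
... | no _  = cong (p *_) (sym (ℚP.*-identityˡ _))

inv-inverseˡ : ∀ r → r ≢ 0ℚ → inv r * r ≡ 1ℚ
inv-inverseˡ r r≢0 with r ℚP.≟ 0ℚ
... | yes r≡0 = contradiction r≡0 r≢0
... | no r≢0′ = trans (cong (_* r) (ℚP.*-identityˡ (ℚ.1/_ r {{≢-nonZero r≢0′}})))
                     (ℚP.*-inverseˡ r {{≢-nonZero r≢0′}})

inv-*-cancelˡ : ∀ r p → r ≢ 0ℚ → inv r * (r * p) ≡ p
inv-*-cancelˡ r p r≢0 = begin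
  inv r * (r * p) ≡⟨ ℚP.*-assoc (inv r) r p ⟨
  inv r * r * p   ≡⟨ cong (_* p) (inv-inverseˡ r r≢0) ⟩
  1ℚ * p          ≡⟨ ℚP.*-identityˡ p ⟩
  p               ∎
  where open ≡-Reasoning

div-*-cancelʳ : ∀ p r → r ≢ 0ℚ → div p r * r ≡ p
div-*-cancelʳ p r r≢0 = begin
  div p r * r   ≡⟨ cong (_* r) (div≡*inv p r) ⟩
  p * inv r * r ≡⟨ ℚP.*-assoc p (inv r) r ⟩
  p * (inv r * r) ≡⟨ cong (p *_) (inv-inverseˡ r r≢0) ⟩
  p * 1ℚ        ≡⟨ ℚP.*-identityʳ p ⟩
  p             ∎
  where open ≡-Reasoning

div-self : ∀ r → r ≢ 0ℚ → div r r ≡ 1ℚ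
div-self r r≢0 = trans (div≡*inv r r) (trans (ℚP.*-comm r (inv r)) (inv-inverseˡ r r≢0))

div-*-div : ∀ a b c → a ≢ 0ℚ → div a b * div c a ≡ div c b
div-*-div a b c a≢0 = begin
  div a b * div c a       ≡⟨ cong₂ _*_ (div≡*inv a b) (div≡*inv c a) ⟩
  a * inv b * (c * inv a) ≡⟨ regroup a (inv b) c (inv a) ⟩
  inv a * a * (c * inv b) ≡⟨ cong (_* (c * inv b)) (inv-inverseˡ a a≢0) ⟩
  1ℚ * (c * inv b)        ≡⟨ ℚP.*-identityˡ _ ⟩
  c * inv b               ≡⟨ div≡*inv c b ⟨
  div c b                 ∎
  where
  open ≡-Reasoning
  open ℚSolver.+-*-Solver
  regroup : ∀ x y z w → x * y * (z * w) ≡ w * x * (z * y)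
  regroup = solve 4 (λ x y z w → x :* y :* (z :* w) := w :* x :* (z :* y)) refl

pow-+ : ∀ p m n → pow p (m ℕ.+ n) ≡ pow p m * pow p n
pow-+ p zero    n = sym (ℚP.*-identityˡ _)
pow-+ p (suc m) n = trans (cong (p *_) (pow-+ p m n)) (sym (ℚP.*-assoc p _ _))

module _ {q t : ℚ} (generic : Generic q t) where

  br-suc≢0ˡ : ∀ a b → br q t (suc a) b ≢ 0ℚ
  br-suc≢0ˡ a b = generic (suc a) b (λ ())

  br-suc≢0ʳ : ∀ a b → br q t a (suc b) ≢ 0ℚ
  br-suc≢0ʳ a b = generic a (suc b) (λ a+1+b≡0 → contradiction (trans (sym (ℕP.+-suc a b)) a+1+b≡0) (λ ()))

module Fold {A : Set} {_∙_ : Op₂ A} {ε : A} (isMonoid : IsMonoid _≡_ _∙_ ε)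
            (big : ℕ → (ℕ → A) → A)
            (big-zero : ∀ f → big 0 f ≡ ε)
            (big-suc : ∀ n f → big (suc n) f ≡ big n f ∙ f (suc n)) where

  open IsMonoid isMonoid using (assoc; identityˡ; identityʳ)
  open ≡-Reasoning

  big-cong : ∀ n {f g : ℕ → A} → (∀ k → 1 ≤ k → k ≤ n → f k ≡ g k) → big n f ≡ big n g
  big-cong zero    {f} {g} _   = trans (big-zero f) (sym (big-zero g))
  big-cong (suc n) {f} {g} f≗g = begin
    big (suc n) f       ≡⟨ big-suc n f ⟩
    big n f ∙ f (suc n) ≡⟨ cong₂ _∙_ (big-cong n (λ k 1≤k k≤n → f≗g k 1≤k (ℕP.m≤n⇒m≤1+n k≤n)))
                                     (f≗g (suc n) (s≤s z≤n) ℕP.≤-refl) ⟩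
    big n g ∙ g (suc n) ≡⟨ big-suc n g ⟨
    big (suc n) g       ∎

  big-ε : ∀ n {f : ℕ → A} → (∀ k → 1 ≤ k → k ≤ n → f k ≡ ε) → big n f ≡ ε
  big-ε zero    {f} _    = big-zero f
  big-ε (suc n) {f} f≡ε = begin
    big (suc n) f       ≡⟨ big-suc n f ⟩
    big n f ∙ f (suc n) ≡⟨ cong₂ _∙_ (big-ε n (λ k 1≤k k≤n → f≡ε k 1≤k (ℕP.m≤n⇒m≤1+n k≤n)))
                                     (f≡ε (suc n) (s≤s z≤n) ℕP.≤-refl) ⟩
    ε ∙ ε               ≡⟨ identityˡ ε ⟩
    ε                   ∎

  big-split : ∀ m n (f : ℕ → A) → big (m ℕ.+ n) f ≡ big m f ∙ big n (λ k → f (m ℕ.+ k))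
  big-split m zero f = begin
    big (m ℕ.+ 0) f ≡⟨ cong (λ s → big s f) (ℕP.+-identityʳ m) ⟩
    big m f         ≡⟨ identityʳ (big m f) ⟨
    big m f ∙ ε     ≡⟨ cong (big m f ∙_) (big-zero _) ⟨
    big m f ∙ big 0 (λ k → f (m ℕ.+ k)) ∎
  big-split m (suc n) f = begin
    big (m ℕ.+ suc n) f                 ≡⟨ cong (λ s → big s f) (ℕP.+-suc m n) ⟩
    big (suc (m ℕ.+ n)) f               ≡⟨ big-suc (m ℕ.+ n) f ⟩
    big (m ℕ.+ n) f ∙ f (suc (m ℕ.+ n)) ≡⟨ cong₂ _∙_ (big-split m n f) (cong f (sym (ℕP.+-suc m n))) ⟩
    (big m f ∙ big n f′) ∙ f′ (suc n)   ≡⟨ assoc _ _ _ ⟩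
    big m f ∙ (big n f′ ∙ f′ (suc n))   ≡⟨ cong (big m f ∙_) (big-suc n f′) ⟨
    big m f ∙ big (suc n) f′            ∎
    where f′ = λ k → f (m ℕ.+ k)

  big-pad : ∀ m n {f : ℕ → A} → (∀ k → m < k → f k ≡ ε) → big (m ℕ.+ n) f ≡ big m f
  big-pad m n {f} f≡ε = begin
    big (m ℕ.+ n) f                      ≡⟨ big-split m n f ⟩
    big m f ∙ big n (λ k → f (m ℕ.+ k))
      ≡⟨ cong (big m f ∙_) (big-ε n (λ k 1≤k _ → f≡ε (m ℕ.+ k) (ℕP.m<m+n m 1≤k))) ⟩
    big m f ∙ ε                          ≡⟨ identityʳ (big m f) ⟩
    big m f                              ∎

open Fold ℚP.+-0-isMonoid sum1 (λ _ → refl) (λ _ _ → refl)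
  using () renaming (big-cong to sum1-cong; big-ε to sum1-≡0; big-split to sum1-split)
open Fold ℚP.*-1-isMonoid prod1 (λ _ → refl) (λ _ _ → refl)
  using () renaming (big-cong to prod1-cong; big-split to prod1-split)
open Fold ℕP.+-0-isMonoid Σℕ1 (λ _ → refl) (λ _ _ → refl)
  using () renaming (big-cong to Σℕ1-cong; big-pad to Σℕ1-pad)

sum1-suc : ∀ n f → sum1 (suc n) f ≡ f 1 + sum1 n (λ k → f (suc k))
sum1-suc n f = trans (sum1-split 1 n f) (cong (_+ sum1 n (λ k → f (suc k))) (ℚP.+-identityˡ (f 1)))

sum1-*ˡ : ∀ n c f → sum1 n (λ k → c * f k) ≡ c * sum1 n f
sum1-*ˡ zero    c f = sym (ℚP.*-zeroʳ c)
sum1-*ˡ (suc n) c f = trans (cong (_+ c * f (suc n)) (sum1-*ˡ n c f)) (sym (ℚP.*-distribˡ-+ c _ _))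

prodOver : ℕ → ℕ → (ℕ → ℚ) → ℚ
prodOver v w f = prod1 (w ∸ v) (λ k → f (v ℕ.+ k))

prodOver-empty : ∀ v f → prodOver v v f ≡ 1ℚ
prodOver-empty v f = cong (λ n → prod1 n (λ k → f (v ℕ.+ k))) (ℕP.n∸n≡0 v)

prodOver-concat : ∀ f {u v w} → u ≤ v → v ≤ w → prodOver u v f * prodOver v w f ≡ prodOver u w f
prodOver-concat f {u} {v} {w} u≤v v≤w = begin
  prodOver u v f * prodOver v w f
    ≡⟨ cong (prodOver u v f *_) (prod1-cong (w ∸ v) (λ k _ _ → cong f shift)) ⟩
  prod1 (v ∸ u) (λ k → f (u ℕ.+ k)) * prod1 (w ∸ v) (λ k → f (u ℕ.+ ((v ∸ u) ℕ.+ k)))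
    ≡⟨ prod1-split (v ∸ u) (w ∸ v) (λ k → f (u ℕ.+ k)) ⟨
  prod1 ((v ∸ u) ℕ.+ (w ∸ v)) (λ k → f (u ℕ.+ k))
    ≡⟨ cong (λ n → prod1 n (λ k → f (u ℕ.+ k))) lengths ⟩
  prodOver u w f ∎
  where
  open ≡-Reasoning
  shift : ∀ {k} → v ℕ.+ k ≡ u ℕ.+ ((v ∸ u) ℕ.+ k)
  shift {k} = trans (cong (ℕ._+ k) (sym (ℕP.m+[n∸m]≡n u≤v))) (ℕP.+-assoc u (v ∸ u) k)
  lengths : (v ∸ u) ℕ.+ (w ∸ v) ≡ w ∸ u
  lengths = begin
    (v ∸ u) ℕ.+ (w ∸ v) ≡⟨ ℕP.+-comm (v ∸ u) (w ∸ v) ⟩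
    (w ∸ v) ℕ.+ (v ∸ u) ≡⟨ ℕP.+-∸-assoc (w ∸ v) u≤v ⟨
    (w ∸ v) ℕ.+ v ∸ u   ≡⟨ cong (_∸ u) (ℕP.m∸n+n≡m v≤w) ⟩
    w ∸ u               ∎

prodOver-telescope : ∀ (ψ : ℕ → ℚ) → (∀ z → ψ z ≢ 0ℚ) → ∀ {v w} → v ≤ w →
  prodOver v w (λ y → div (ψ y) (ψ (pred y))) ≡ div (ψ w) (ψ v)
prodOver-telescope ψ ψ≢0 {v} {w} v≤w =
  trans (telescope (w ∸ v)) (cong (λ z → div (ψ z) (ψ v)) (ℕP.m+[n∸m]≡n v≤w))
  where
  telescope : ∀ n → prod1 n (λ k → div (ψ (v ℕ.+ k)) (ψ (pred (v ℕ.+ k)))) ≡ div (ψ (v ℕ.+ n)) (ψ v)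
  telescope zero = begin
    1ℚ                           ≡⟨ div-self (ψ v) (ψ≢0 v) ⟨
    div (ψ v) (ψ v)              ≡⟨ cong (λ z → div (ψ z) (ψ v)) (ℕP.+-identityʳ v) ⟨
    div (ψ (v ℕ.+ 0)) (ψ v)      ∎
    where open ≡-Reasoning
  telescope (suc n) = begin
    prod1 n _ * div (ψ (v ℕ.+ suc n)) (ψ (pred (v ℕ.+ suc n)))
      ≡⟨ cong₂ (λ p z → p * div (ψ (v ℕ.+ suc n)) (ψ (pred z))) (telescope n) (ℕP.+-suc v n) ⟩
    div (ψ (v ℕ.+ n)) (ψ v) * div (ψ (v ℕ.+ suc n)) (ψ (v ℕ.+ n))
      ≡⟨ div-*-div (ψ (v ℕ.+ n)) (ψ v) (ψ (v ℕ.+ suc n)) (ψ≢0 _) ⟩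
    div (ψ (v ℕ.+ suc n)) (ψ v) ∎
    where open ≡-Reasoning

prodOver-cong : ∀ {f g v w} → v ≤ w → (∀ y → v < y → y ≤ w → f y ≡ g y) → prodOver v w f ≡ prodOver v w g
prodOver-cong {v = v} {w} v≤w f≗g = prod1-cong (w ∸ v) (λ k 1≤k k≤w∸v →
  f≗g (v ℕ.+ k) (ℕP.m<m+n v 1≤k) (subst (v ℕ.+ k ≤_) (ℕP.m+[n∸m]≡n v≤w) (ℕP.+-monoʳ-≤ v k≤w∸v)))

prodOver-peel : ∀ f (ψ : ℕ → ℚ) → (∀ z → ψ z ≢ 0ℚ) → ∀ {u v w} → u ≤ v → v ≤ w →
  (∀ y → u < y → y ≤ v → f y ≡ div (ψ y) (ψ (pred y))) →
  prodOver u w f ≡ div (ψ v) (ψ u) * prodOver v w f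
prodOver-peel f ψ ψ≢0 {u} {v} {w} u≤v v≤w f≡ratio = begin
  prodOver u w f                   ≡⟨ prodOver-concat f u≤v v≤w ⟨
  prodOver u v f * prodOver v w f  ≡⟨ cong (_* prodOver v w f) (prodOver-cong u≤v f≡ratio) ⟩
  prodOver u v (λ y → div (ψ y) (ψ (pred y))) * prodOver v w f
                                   ≡⟨ cong (_* prodOver v w f) (prodOver-telescope ψ ψ≢0 u≤v) ⟩
  div (ψ v) (ψ u) * prodOver v w f ∎
  where open ≡-Reasoning

Σℕ1-bump : ∀ n c {f g : ℕ → ℕ} → 1 ≤ c → c ≤ n → g c ≡ suc (f c) →
  (∀ k → 1 ≤ k → k ≤ n → k ≢ c → g k ≡ f k) →
  Σℕ1 n g ≡ suc (Σℕ1 n f)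
Σℕ1-bump zero    c 1≤c c≤0 _ _ = contradiction (ℕP.≤-trans 1≤c c≤0) (λ ())
Σℕ1-bump (suc n) c {f} {g} 1≤c c≤1+n gc g≡f with suc n ≟ c
... | yes refl = begin
  Σℕ1 n g ℕ.+ g (suc n)
    ≡⟨ cong₂ ℕ._+_ (Σℕ1-cong n (λ k 1≤k k≤n → g≡f k 1≤k (ℕP.m≤n⇒m≤1+n k≤n) (ℕP.<⇒≢ (s≤s k≤n)))) gc ⟩
  Σℕ1 n f ℕ.+ suc (f (suc n))
    ≡⟨ ℕP.+-suc (Σℕ1 n f) (f (suc n)) ⟩
  suc (Σℕ1 n f ℕ.+ f (suc n)) ∎
  where open ≡-Reasoning
... | no 1+n≢c = cong₂ ℕ._+_ (Σℕ1-bump n c 1≤c c≤n gc (λ k 1≤k k≤n → g≡f k 1≤k (ℕP.m≤n⇒m≤1+n k≤n)))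
                                (g≡f (suc n) (s≤s z≤n) ℕP.≤-refl 1+n≢c)
  where c≤n = ℕP.≤-pred (ℕP.≤∧≢⇒< c≤1+n (λ c≡1+n → 1+n≢c (sym c≡1+n)))

Σℕ1-suc-prefix : ∀ n m {f g : ℕ → ℕ} → m ≤ n →
  (∀ k → 1 ≤ k → k ≤ m → g k ≡ suc (f k)) → (∀ k → m < k → k ≤ n → g k ≡ f k) →
  Σℕ1 n g ≡ Σℕ1 n f ℕ.+ m
Σℕ1-suc-prefix zero .zero z≤n _ _ = refl
Σℕ1-suc-prefix (suc n) m {f} {g} m≤1+n g≡1+f g≡f with m ℕ.≤? n
... | yes m≤n = begin
  Σℕ1 n g ℕ.+ g (suc n)
    ≡⟨ cong₂ ℕ._+_ (Σℕ1-suc-prefix n m m≤n g≡1+f (λ k m<k k≤n → g≡f k m<k (ℕP.m≤n⇒m≤1+n k≤n)))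
                   (g≡f (suc n) (s≤s m≤n) ℕP.≤-refl) ⟩
  Σℕ1 n f ℕ.+ m ℕ.+ f (suc n)
    ≡⟨ swap (Σℕ1 n f) m (f (suc n)) ⟩
  Σℕ1 n f ℕ.+ f (suc n) ℕ.+ m         ∎
  where
  open ≡-Reasoning
  open ℕSolver.+-*-Solver
  swap : ∀ a b c → a ℕ.+ b ℕ.+ c ≡ a ℕ.+ c ℕ.+ b
  swap = solve 3 (λ a b c → a :+ b :+ c := a :+ c :+ b) refl
... | no m≰n = begin
  Σℕ1 n g ℕ.+ g (suc n)
    ≡⟨ cong₂ ℕ._+_ (Σℕ1-suc-prefix n n ℕP.≤-refl (λ k 1≤k k≤n → g≡1+f k 1≤k (ℕP.≤-trans k≤n n≤m))
                                                (λ k n<k k≤n → contradiction k≤n (ℕP.<⇒≱ n<k)))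
                   (g≡1+f (suc n) (s≤s z≤n) 1+n≤m) ⟩
  Σℕ1 n f ℕ.+ n ℕ.+ suc (f (suc n))
    ≡⟨ swap (Σℕ1 n f) n (f (suc n)) ⟩
  Σℕ1 n f ℕ.+ f (suc n) ℕ.+ suc n
    ≡⟨ cong (Σℕ1 n f ℕ.+ f (suc n) ℕ.+_) m≡1+n ⟨
  Σℕ1 n f ℕ.+ f (suc n) ℕ.+ m         ∎
  where
  open ≡-Reasoning
  open ℕSolver.+-*-Solver
  1+n≤m = ℕP.≰⇒> m≰n
  n≤m = ℕP.<⇒≤ 1+n≤m
  m≡1+n = ℕP.≤-antisym m≤1+n 1+n≤m
  swap : ∀ a b c → a ℕ.+ b ℕ.+ suc c ≡ a ℕ.+ c ℕ.+ suc b
  swap = solve 3 (λ a b c → a :+ b :+ (con 1 :+ c) := a :+ c :+ (con 1 :+ b)) refl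

Decreasing : List ℕ → Set
Decreasing l = ∀ y → row l (suc (suc y)) ≤ row l (suc y)

col-∷-≤ : ∀ {x k} ks → x ≤ k → col (k ∷ ks) x ≡ suc (col ks x)
col-∷-≤ {x} ks x≤k = cong length (filter-accept (x ℕ.≤?_) x≤k)

col-∷-≰ : ∀ {x k} ks → ¬ x ≤ k → col (k ∷ ks) x ≡ col ks x
col-∷-≰ {x} ks x≰k = cong length (filter-reject (x ℕ.≤?_) x≰k)

row-beyond-length : ∀ l {y} → length l < y → row l y ≡ 0
row-beyond-length []       _                         = refl
row-beyond-length (k ∷ ks) {suc zero}    (s≤s ())
row-beyond-length (k ∷ ks) {suc (suc y)} (s≤s len<y) = row-beyond-length ks len<y

row-antitone : ∀ l → Decreasing l → ∀ {y z} → 1 ≤ y → y ≤ z → row l z ≤ row l y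
row-antitone l dec {y} {zero}  1≤y y≤0   = contradiction (ℕP.≤-trans 1≤y y≤0) (λ ())
row-antitone l dec {y} {suc z} 1≤y y≤1+z with y ℕ.≤? z
... | yes y≤z = ℕP.≤-trans (step z (ℕP.≤-trans 1≤y y≤z)) (row-antitone l dec 1≤y y≤z)
  where
  step : ∀ z → 1 ≤ z → row l (suc z) ≤ row l z
  step (suc z) _ = dec z
... | no y≰z = ℕP.≤-reflexive (cong (row l) (ℕP.≤-antisym (ℕP.≰⇒> y≰z) y≤1+z))

-- x ≤ λ_y ⇔ y ≤ λ'_x : both say that (x , y) is a cell of λ.
≤row⇒≤col : ∀ l → Decreasing l → ∀ {x y} → 1 ≤ x → x ≤ row l y → y ≤ col l x
≤row⇒≤col []       _   1≤x x≤0 = contradiction (ℕP.≤-trans 1≤x x≤0) (λ ())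
≤row⇒≤col (k ∷ ks) _   {y = zero}          _ _   = z≤n
≤row⇒≤col (k ∷ ks) _   {x} {suc zero}    _ x≤k =
  subst (1 ≤_) (sym (col-∷-≤ ks x≤k)) (s≤s z≤n)
≤row⇒≤col (k ∷ ks) dec {x} {suc (suc y)} 1≤x x≤row =
  subst (suc (suc y) ≤_) (sym (col-∷-≤ ks x≤k)) (s≤s (≤row⇒≤col ks (λ y → dec (suc y)) 1≤x x≤row))
  where x≤k = ℕP.≤-trans x≤row (row-antitone (k ∷ ks) dec {1} {suc (suc y)} (s≤s z≤n) (s≤s z≤n))

≤col⇒≤row : ∀ l → Decreasing l → ∀ {x y} → 1 ≤ y → y ≤ col l x → x ≤ row l y
≤col⇒≤row []       _   1≤y y≤0 = contradiction (ℕP.≤-trans 1≤y y≤0) (λ ())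
≤col⇒≤row (k ∷ ks) dec {x} {suc y} 1≤y y≤col with x ℕ.≤? k
≤col⇒≤row (k ∷ ks) dec {x} {suc zero}    _ _ | yes x≤k = x≤k
≤col⇒≤row (k ∷ ks) dec {x} {suc (suc y)} _ y≤col | yes x≤k =
  ≤col⇒≤row ks (λ y → dec (suc y)) (s≤s z≤n) (ℕP.≤-pred (subst (suc (suc y) ≤_) (col-∷-≤ ks x≤k) y≤col))
≤col⇒≤row (k ∷ ks) dec {x} {suc zero}    _ y≤col | no x≰k =
  ℕP.≤-trans (≤col⇒≤row ks (λ y → dec (suc y)) (s≤s z≤n) (subst (1 ≤_) (col-∷-≰ ks x≰k) y≤col)) (dec 0)
≤col⇒≤row (k ∷ ks) dec {x} {suc (suc y)} _ y≤col | no x≰k =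
  ≤col⇒≤row ks (λ y → dec (suc y)) (s≤s z≤n)
    (ℕP.≤-trans (ℕP.n≤1+n (suc y)) (subst (suc (suc y) ≤_) (col-∷-≰ ks x≰k) y≤col))

col-≤ : ∀ l m → Decreasing l → Decreasing m → ∀ {x} → 1 ≤ x →
  (∀ {y} → 1 ≤ y → x ≤ row l y → x ≤ row m y) → col l x ≤ col m x
col-≤ l m dec-l dec-m {x} 1≤x rows-≤ with col l x in col≡
... | zero  = z≤n
... | suc c =
  ≤row⇒≤col m dec-m 1≤x (rows-≤ (s≤s z≤n) (≤col⇒≤row l dec-l (s≤s z≤n) (ℕP.≤-reflexive (sym col≡))))

col-antitone : ∀ l → Decreasing l → ∀ {x x′} → 1 ≤ x → x ≤ x′ → col l x′ ≤ col l x
col-antitone l dec {x} {x′} 1≤x x≤x′ with col l x′ in col≡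
... | zero  = z≤n
... | suc c =
  ≤row⇒≤col l dec 1≤x (ℕP.≤-trans x≤x′ (≤col⇒≤row l dec (s≤s z≤n) (ℕP.≤-reflexive (sym col≡))))

row-between : ∀ l → Decreasing l → ∀ {x y} → 1 ≤ x → 1 ≤ y →
  col l (suc x) < y → y ≤ col l x → row l y ≡ x
row-between l dec 1≤x 1≤y col<y y≤col = ℕP.≤-antisym
  (ℕP.≮⇒≥ λ x<row → ℕP.<⇒≱ col<y (≤row⇒≤col l dec (s≤s z≤n) x<row))
  (≤col⇒≤row l dec 1≤y y≤col)

col-between : ∀ l → Decreasing l → ∀ {x y} → 1 ≤ x → 1 ≤ y →
  row l (suc y) < x → x ≤ row l y → col l x ≡ y
col-between l dec 1≤x 1≤y row<x x≤row = ℕP.≤-antisym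
  (ℕP.≮⇒≥ λ y<col → ℕP.<⇒≱ row<x (≤col⇒≤row l dec (s≤s z≤n) y<col))
  (≤row⇒≤col l dec 1≤x x≤row)

row≡0 : ∀ l → Decreasing l → ∀ {y} → 1 ≤ y → col l 1 < y → row l y ≡ 0
row≡0 l dec 1≤y col<y =
  ℕP.n≤0⇒n≡0 (ℕP.≮⇒≥ λ 0<row → ℕP.<⇒≱ col<y (≤row⇒≤col l dec (s≤s z≤n) 0<row))

col≡0 : ∀ l → Decreasing l → ∀ {x} → row l 1 < x → col l x ≡ 0
col≡0 l dec row<x =
  ℕP.n≤0⇒n≡0 (ℕP.≮⇒≥ λ 0<col → ℕP.<⇒≱ row<x (≤col⇒≤row l dec (s≤s z≤n) 0<col))

-- The factors of α_{ν/λ}: in ν the cells below ν/λ have one more leg, those left of it one more arm.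
colFactor : List ℕ → ℚ → ℚ → ℕ → ℕ → ℚ
colFactor lam q t i y =
  div (br q t (suc (armIn lam i y)) (legIn lam i y)) (br q t (suc (armIn lam i y)) (suc (legIn lam i y)))

rowFactor : List ℕ → ℚ → ℚ → ℕ → ℕ → ℚ
rowFactor lam q t j x =
  div (br q t (armIn lam x j) (suc (legIn lam x j))) (br q t (suc (armIn lam x j)) (suc (legIn lam x j)))

legSum : List ℕ → ℕ → ℕ
legSum l y = Σℕ1 (row l y) (λ x → col l x ∸ y)

nFun-pad : ∀ l m → nFun l ≡ Σℕ1 (length l ℕ.+ m) (legSum l)
nFun-pad l m = sym (Σℕ1-pad (length l) m λ y len<y →
  cong (λ n → Σℕ1 n (λ x → col l x ∸ y)) (row-beyond-length l len<y))

module AddedCell (lam nu : List ℕ) (lam-dec : Decreasing lam) (nu-dec : Decreasing nu) (j0 : ℕ)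
                 (nu-row : row nu (suc j0) ≡ suc (row lam (suc j0)))
                 (nu-other : ∀ y → y ≢ suc j0 → row nu y ≡ row lam y) where

  j r i : ℕ
  j = suc j0
  r = row lam j
  i = suc r

  row-≤ : ∀ y → row lam y ≤ row nu y
  row-≤ y with y ≟ j
  ... | yes refl = subst (r ≤_) (sym nu-row) (ℕP.n≤1+n r)
  ... | no y≢j   = ℕP.≤-reflexive (sym (nu-other y y≢j))

  i≤row-below : ∀ {y} → 1 ≤ y → y ≤ j0 → i ≤ row lam y
  i≤row-below {y} 1≤y y≤j0 = begin
    i          ≡⟨ nu-row ⟨
    row nu j   ≤⟨ row-antitone nu nu-dec 1≤y (ℕP.m≤n⇒m≤1+n y≤j0) ⟩
    row nu y   ≡⟨ nu-other y (ℕP.<⇒≢ (s≤s y≤j0)) ⟩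
    row lam y  ∎
    where open ℕP.≤-Reasoning

  col-corner : col lam i ≡ j0
  col-corner = ℕP.≤-antisym
    (ℕP.≮⇒≥ λ j0<col → ℕP.<-irrefl refl (≤col⇒≤row lam lam-dec (s≤s z≤n) j0<col))
    (below j0 ℕP.≤-refl)
    where
    below : ∀ y → y ≤ j0 → y ≤ col lam i
    below zero    _    = z≤n
    below (suc y) y≤j0 = ≤row⇒≤col lam lam-dec (s≤s z≤n) (i≤row-below (s≤s z≤n) y≤j0)

  col-added : col nu i ≡ j
  col-added = col-between nu nu-dec (s≤s z≤n) (s≤s z≤n) (s≤s row-above≤r) (ℕP.≤-reflexive (sym nu-row))
    where
    row-above≤r : row nu (suc j) ≤ r
    row-above≤r = subst (_≤ r) (sym (nu-other (suc j) (ℕP.1+n≢n {j})))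
                        (row-antitone lam lam-dec (s≤s z≤n) (ℕP.n≤1+n j))

  col-unchanged : ∀ {x} → 1 ≤ x → x ≢ i → col nu x ≡ col lam x
  col-unchanged {x} 1≤x x≢i = ℕP.≤-antisym (col-≤ nu lam nu-dec lam-dec 1≤x shrink)
                                           (col-≤ lam nu lam-dec nu-dec 1≤x (λ _ x≤row → ℕP.≤-trans x≤row (row-≤ _)))
    where
    shrink : ∀ {y} → 1 ≤ y → x ≤ row nu y → x ≤ row lam y
    shrink {y} _ x≤row with y ≟ j
    ... | yes refl = ℕP.≤-pred (ℕP.≤∧≢⇒< (subst (x ≤_) nu-row x≤row) x≢i)
    ... | no y≢j   = subst (x ≤_) (nu-other y y≢j) x≤row

  leg-added : ∀ {y} → y ≤ j0 → col nu i ∸ y ≡ suc (col lam i ∸ y)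
  leg-added {y} y≤j0 = begin
    col nu i ∸ y         ≡⟨ cong (_∸ y) col-added ⟩
    suc j0 ∸ y           ≡⟨ suc-∸ y≤j0 ⟩
    suc (j0 ∸ y)         ≡⟨ cong (λ c → suc (c ∸ y)) col-corner ⟨
    suc (col lam i ∸ y)  ∎
    where open ≡-Reasoning

  legSum-below : ∀ {y} → 1 ≤ y → y ≤ j0 → legSum nu y ≡ suc (legSum lam y)
  legSum-below {y} 1≤y y≤j0 = begin
    Σℕ1 (row nu y) (λ x → col nu x ∸ y)
      ≡⟨ cong (λ n → Σℕ1 n (λ x → col nu x ∸ y)) (nu-other y (ℕP.<⇒≢ (s≤s y≤j0))) ⟩
    Σℕ1 (row lam y) (λ x → col nu x ∸ y)
      ≡⟨ Σℕ1-bump (row lam y) i (s≤s z≤n) (i≤row-below 1≤y y≤j0) (leg-added y≤j0)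
                  (λ x 1≤x _ x≢i → cong (_∸ y) (col-unchanged 1≤x x≢i)) ⟩
    suc (legSum lam y) ∎
    where open ≡-Reasoning

  legSum-above : ∀ {y} → j0 < y → legSum nu y ≡ legSum lam y
  legSum-above {y} j0<y with y ≟ j
  ... | yes refl = begin
    Σℕ1 (row nu j) (λ x → col nu x ∸ j)
      ≡⟨ cong (λ n → Σℕ1 n (λ x → col nu x ∸ j)) nu-row ⟩
    Σℕ1 r (λ x → col nu x ∸ j) ℕ.+ (col nu i ∸ j)
      ≡⟨ cong₂ ℕ._+_ (Σℕ1-cong r (λ x 1≤x x≤r → cong (_∸ j) (col-unchanged 1≤x (ℕP.<⇒≢ (s≤s x≤r)))))
                     (trans (cong (_∸ j) col-added) (ℕP.n∸n≡0 j)) ⟩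
    legSum lam j ℕ.+ 0
      ≡⟨ ℕP.+-identityʳ _ ⟩
    legSum lam j ∎
    where open ≡-Reasoning
  ... | no y≢j = trans (cong (λ n → Σℕ1 n (λ x → col nu x ∸ y)) (nu-other y y≢j))
                       (Σℕ1-cong (row lam y) (λ x 1≤x x≤row → cong (_∸ y) (col-unchanged 1≤x (x≢i x≤row))))
    where
    x≢i : ∀ {x} → x ≤ row lam y → x ≢ i
    x≢i x≤row = ℕP.<⇒≢ (s≤s (ℕP.≤-trans x≤row (row-antitone lam lam-dec (s≤s z≤n) j0<y)))

  n-added : nFun nu ∸ nFun lam ≡ j0
  n-added = trans (cong (_∸ nFun lam) nFun-nu) (ℕP.m+n∸m≡n (nFun lam) j0)
    where
    open ≡-Reasoning
    N = length lam ℕ.+ length nu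
    j0≤N : j0 ≤ N
    j0≤N = ℕP.≤-trans (subst (_≤ length lam) col-corner (length-filter (i ℕ.≤?_) lam)) (ℕP.m≤m+n _ _)
    nFun-nu : nFun nu ≡ nFun lam ℕ.+ j0
    nFun-nu = begin
      nFun nu
        ≡⟨ nFun-pad nu (length lam) ⟩
      Σℕ1 (length nu ℕ.+ length lam) (legSum nu)
        ≡⟨ cong (λ n → Σℕ1 n (legSum nu)) (ℕP.+-comm (length nu) (length lam)) ⟩
      Σℕ1 N (legSum nu)
        ≡⟨ Σℕ1-suc-prefix N j0 j0≤N (λ _ → legSum-below) (λ _ j0<y _ → legSum-above j0<y) ⟩
      Σℕ1 N (legSum lam) ℕ.+ j0
        ≡⟨ cong (ℕ._+ j0) (nFun-pad lam (length nu)) ⟨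
      nFun lam ℕ.+ j0 ∎

  alpha-corner : ∀ q t → alpha lam nu i j q t ≡ prod1 r (rowFactor lam q t j) * prod1 j0 (colFactor lam q t i)
  alpha-corner q t = cong₂ _*_
    (prod1-cong r row-factor)
    (trans (cong (λ n → prod1 n colFactorν) col-corner) (prod1-cong j0 col-factor))
    where
    colFactorν : ℕ → ℚ
    colFactorν y = div (br q t (suc (armIn lam i y)) (legIn lam i y)) (br q t (suc (armIn nu i y)) (legIn nu i y))
    row-factor : ∀ x → 1 ≤ x → x ≤ r →
      div (br q t (armIn lam x j) (suc (legIn lam x j))) (br q t (armIn nu x j) (suc (legIn nu x j)))
        ≡ rowFactor lam q t j x
    row-factor x 1≤x x≤r = cong₂ (λ a ℓ → div (br q t (armIn lam x j) (suc (legIn lam x j))) (br q t a (suc ℓ)))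
      (trans (cong (_∸ x) nu-row) (suc-∸ x≤r))
      (cong (_∸ j) (col-unchanged 1≤x (ℕP.<⇒≢ (s≤s x≤r))))
    col-factor : ∀ y → 1 ≤ y → y ≤ j0 → colFactorν y ≡ colFactor lam q t i y
    col-factor y _ y≤j0 = cong₂ (λ a ℓ → div (br q t (suc (armIn lam i y)) (legIn lam i y)) (br q t (suc a) ℓ))
      (cong (_∸ i) (nu-other y (ℕP.<⇒≢ (s≤s y≤j0))))
      (leg-added y≤j0)

module ArmFactor (q t : ℚ) (generic : Generic q t)
                 (m : ℕ → ℕ) (m-zero : m 0 ≡ 0) (m-step : ∀ d → m d ≤ m (suc d)) where

  armProduct : ℕ → ℚ
  armProduct zero    = 1ℚ
  armProduct (suc d) = armProduct d * div (br q t (suc d) (m d)) (br q t (suc d) (m (suc d)))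

  armWeight : ℕ → ℚ
  armWeight d = pow t (m d) * armProduct d

  armSeries : ℕ → ℚ
  armSeries d = sum1 d (λ k → pow q (d ∸ k) * (1ℚ - q) * armWeight (d ∸ k))

  armSeries-closed : ∀ d → pow t (m d) * armSeries d ≡ armWeight d * br q t d (m d)
  armSeries-closed zero = begin
    pow t (m 0) * 0ℚ         ≡⟨ ℚP.*-zeroʳ (pow t (m 0)) ⟩
    0ℚ                       ≡⟨ ℚP.*-zeroʳ (armWeight 0) ⟨
    armWeight 0 * 0ℚ         ≡⟨ cong (λ k → armWeight 0 * br q t 0 k) m-zero ⟨
    armWeight 0 * br q t 0 (m 0) ∎
    where open ≡-Reasoning
  armSeries-closed (suc d) = begin
    pow t (m (suc d)) * armSeries (suc d)
      ≡⟨ cong₂ _*_ t^m′ (sum1-suc d (λ k → pow q (suc d ∸ k) * (1ℚ - q) * armWeight (suc d ∸ k))) ⟩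
    (Tm * Tδ) * (Qd * (1ℚ - q) * (Tm * armProduct d) + armSeries d)
      ≡⟨ solve 6 (λ Tm Tδ Qd q P S → (Tm :* Tδ) :* (Qd :* (con 1ℚ :- q) :* (Tm :* P) :+ S)
                                 := Tδ :* (Tm :* Qd :* (con 1ℚ :- q) :* Tm :* P :+ Tm :* S)) refl
                 Tm Tδ Qd q (armProduct d) (armSeries d) ⟩
    Tδ * (Tm * Qd * (1ℚ - q) * Tm * armProduct d + Tm * armSeries d)
      ≡⟨ cong (λ s → Tδ * (Tm * Qd * (1ℚ - q) * Tm * armProduct d + s)) (armSeries-closed d) ⟩
    Tδ * (Tm * Qd * (1ℚ - q) * Tm * armProduct d + Tm * armProduct d * (1ℚ - Qd * Tm))
      ≡⟨ solve 5 (λ Tm Tδ Qd q P → Tδ :* (Tm :* Qd :* (con 1ℚ :- q) :* Tm :* P :+ Tm :* P :* (con 1ℚ :- Qd :* Tm))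
                              := (Tm :* Tδ) :* P :* (con 1ℚ :- q :* Qd :* Tm)) refl
                 Tm Tδ Qd q (armProduct d) ⟩
    (Tm * Tδ) * armProduct d * old
      ≡⟨ cong (λ z → z * armProduct d * old) t^m′ ⟨
    pow t (m (suc d)) * armProduct d * old
      ≡⟨ cong (pow t (m (suc d)) * armProduct d *_) (div-*-cancelʳ old new (br-suc≢0ˡ generic d (m (suc d)))) ⟨
    pow t (m (suc d)) * armProduct d * (div old new * new)
      ≡⟨ solve 4 (λ a b c e → a :* b :* (c :* e) := a :* (b :* c) :* e) refl
                 (pow t (m (suc d))) (armProduct d) (div old new) new ⟩
    armWeight (suc d) * br q t (suc d) (m (suc d)) ∎
    where
    open ≡-Reasoning
    open ℚSolver.+-*-Solver
    Tm = pow t (m d)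
    Tδ = pow t (m (suc d) ∸ m d)
    Qd = pow q d
    old = br q t (suc d) (m d)
    new = br q t (suc d) (m (suc d))
    t^m′ : pow t (m (suc d)) ≡ Tm * Tδ
    t^m′ = trans (cong (pow t) (sym (ℕP.m+[n∸m]≡n (m-step d)))) (pow-+ t (m d) _)

module LegFactor (q t : ℚ) (generic : Generic q t) (p : ℕ → ℕ) (p-zero : p 0 ≡ 0) where

  legWeight : ℕ → ℚ
  legWeight zero    = 1ℚ
  legWeight (suc e) = legWeight e * div (br q t (p e) (suc e)) (br q t (p (suc e)) (suc e))

  legSeries : ℕ → ℚ
  legSeries e = sum1 e (λ k → pow t (k ∸ 1) * (1ℚ - t) * legWeight (e ∸ k))

  legSeries-closed : ∀ e → legSeries e ≡ legWeight e * br q t (p e) e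
  legSeries-closed zero = begin
    0ℚ                        ≡⟨ ℚP.*-zeroʳ 1ℚ ⟨
    1ℚ * 0ℚ                   ≡⟨ cong (λ k → 1ℚ * br q t k 0) p-zero ⟨
    1ℚ * br q t (p 0) 0       ∎
    where open ≡-Reasoning
  legSeries-closed (suc e) = begin
    legSeries (suc e)
      ≡⟨ sum1-suc e (λ k → pow t (k ∸ 1) * (1ℚ - t) * legWeight (suc e ∸ k)) ⟩
    1ℚ * (1ℚ - t) * legWeight e + sum1 e (λ k → pow t k * (1ℚ - t) * legWeight (e ∸ k))
      ≡⟨ cong (1ℚ * (1ℚ - t) * legWeight e +_) (trans (sum1-cong e shift) (sum1-*ˡ e t _)) ⟩
    1ℚ * (1ℚ - t) * legWeight e + t * legSeries e
      ≡⟨ cong (λ s → 1ℚ * (1ℚ - t) * legWeight e + t * s) (legSeries-closed e) ⟩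
    1ℚ * (1ℚ - t) * legWeight e + t * (legWeight e * (1ℚ - Qp * Te))
      ≡⟨ solve 4 (λ H t Qp Te → con 1ℚ :* (con 1ℚ :- t) :* H :+ t :* (H :* (con 1ℚ :- Qp :* Te))
                            := H :* (con 1ℚ :- Qp :* (t :* Te))) refl
                 (legWeight e) t Qp Te ⟩
    legWeight e * old
      ≡⟨ cong (legWeight e *_) (div-*-cancelʳ old new (br-suc≢0ʳ generic (p (suc e)) e)) ⟨
    legWeight e * (div old new * new)
      ≡⟨ ℚP.*-assoc (legWeight e) _ _ ⟨
    legWeight (suc e) * br q t (p (suc e)) (suc e) ∎
    where
    open ≡-Reasoning
    open ℚSolver.+-*-Solver
    Qp = pow q (p e)
    Te = pow t e
    old = br q t (p e) (suc e)
    new = br q t (p (suc e)) (suc e)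
    shift : ∀ k → 1 ≤ k → k ≤ e →
      pow t k * (1ℚ - t) * legWeight (e ∸ k) ≡ t * (pow t (k ∸ 1) * (1ℚ - t) * legWeight (e ∸ k))
    shift (suc k) _ _ = solve 4 (λ a b c h → a :* b :* c :* h := a :* (b :* c :* h)) refl
                              t (pow t k) (1ℚ - t) (legWeight (e ∸ suc k))

-- walk lam q t (suc n) x y i j is definitionally walkStep lam q t n x y i j (extArm lam x y) (extLeg lam x y).
walkStep : List ℕ → ℚ → ℚ → ℕ → ℕ → ℕ → ℕ → ℕ → ℕ → ℕ → ℚ
walkStep lam q t n x y i j a l =
  if isZero a ∧ isZero l
  then (if eqCell x y i j then 1ℚ else 0ℚ)
  else (sum1 a (λ k → div (pow q (a ∸ k) * pow t l * (1ℚ - q)) (br q t a l) * walk lam q t n (x ∸ k) y i j)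
        + sum1 l (λ k → div (pow t (k ∸ 1) * (1ℚ - t)) (br q t a l) * walk lam q t n x (y ∸ k) i j))

if-same : ∀ {A : Set} b {u v w : A} → u ≡ w → v ≡ w → (if b then u else v) ≡ w
if-same true  u≡w _   = u≡w
if-same false _   v≡w = v≡w

if-false : ∀ {A : Set} {b} {u v : A} → b ≡ false → (if b then u else v) ≡ v
if-false refl = refl

eqCell-refl : ∀ x y → eqCell x y x y ≡ true
eqCell-refl x y with x ≟ x | y ≟ y
... | yes _   | yes _   = refl
... | no x≢x  | _       = contradiction refl x≢x
... | yes _   | no y≢y  = contradiction refl y≢y

eqCell-outside : ∀ {x y i j} → x < i ⊎ y < j → eqCell x y i j ≡ false
eqCell-outside {x} {i = i} (inj₁ x<i) with x ≟ i
... | yes x≡i = contradiction x≡i (ℕP.<⇒≢ x<i)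
... | no _    = refl
eqCell-outside {y = y} {j = j} (inj₂ y<j) with y ≟ j
... | yes y≡j = contradiction y≡j (ℕP.<⇒≢ y<j)
... | no _    = BoolP.∧-zeroʳ _

*≡0ʳ : ∀ c {w} → w ≡ 0ℚ → c * w ≡ 0ℚ
*≡0ʳ c refl = ℚP.*-zeroʳ c

-- Every step decreases a coordinate, so a walk starting left of or below the target never reaches it.
walk-outside : ∀ lam q t n {x y i j} → x < i ⊎ y < j → walk lam q t n x y i j ≡ 0ℚ
walk-outside lam q t zero    _ = refl
walk-outside lam q t (suc n) {x} {y} {i} {j} outside =
  if-same (isZero a ∧ isZero l) (cong (if_then 1ℚ else 0ℚ) (eqCell-outside outside))
    (trans (cong₂ _+_ (sum1-≡0 a arm-step) (sum1-≡0 l leg-step)) (ℚP.+-identityˡ 0ℚ))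
  where
  a = extArm lam x y
  l = extLeg lam x y
  armCoeff legCoeff : ℕ → ℚ
  armCoeff k = div (pow q (a ∸ k) * pow t l * (1ℚ - q)) (br q t a l)
  legCoeff k = div (pow t (k ∸ 1) * (1ℚ - t)) (br q t a l)
  arm-step : ∀ k → 1 ≤ k → k ≤ a → armCoeff k * walk lam q t n (x ∸ k) y i j ≡ 0ℚ
  arm-step k _ _ = *≡0ʳ (armCoeff k) (walk-outside lam q t n (Sum.map₁ (ℕP.≤-<-trans (ℕP.m∸n≤m x k)) outside))
  leg-step : ∀ k → 1 ≤ k → k ≤ l → legCoeff k * walk lam q t n x (y ∸ k) i j ≡ 0ℚ
  leg-step k _ _ = *≡0ʳ (legCoeff k) (walk-outside lam q t n (Sum.map₂ (ℕP.≤-<-trans (ℕP.m∸n≤m y k)) outside))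

module CornerWalk (lam : List ℕ) (lam-dec : Decreasing lam) (j0 : ℕ)
                  (col-corner : col lam (suc (row lam (suc j0))) ≡ j0)
                  (q t : ℚ) (generic : Generic q t) where

  j r i : ℕ
  j = suc j0
  r = row lam j
  i = suc r

  colAt rowAt : ℕ → ℕ
  colAt d = col lam (i ℕ.+ d)
  rowAt e = row lam (j ℕ.+ e)

  colAt≤ : ∀ d → colAt d ≤ j0
  colAt≤ d = subst (colAt d ≤_) col-corner (col-antitone lam lam-dec (s≤s z≤n) (ℕP.m≤m+n i d))

  colAt-step : ∀ d → colAt (suc d) ≤ colAt d
  colAt-step d = col-antitone lam lam-dec (s≤s z≤n) (ℕP.+-monoʳ-≤ i (ℕP.n≤1+n d))

  rowAt≤ : ∀ e → rowAt e ≤ r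
  rowAt≤ e = row-antitone lam lam-dec (s≤s z≤n) (ℕP.m≤m+n j e)

  rowAt-step : ∀ e → rowAt (suc e) ≤ rowAt e
  rowAt-step e = row-antitone lam lam-dec (s≤s z≤n) (ℕP.+-monoʳ-≤ j (ℕP.n≤1+n e))

  legGap armGap : ℕ → ℕ
  legGap d = j0 ∸ colAt d
  armGap e = r ∸ rowAt e

  legGap-zero : legGap 0 ≡ 0
  legGap-zero = trans (cong (λ x → j0 ∸ col lam x) (ℕP.+-identityʳ i))
                      (trans (cong (j0 ∸_) col-corner) (ℕP.n∸n≡0 j0))

  armGap-zero : armGap 0 ≡ 0
  armGap-zero = trans (cong (λ y → r ∸ row lam y) (ℕP.+-identityʳ j)) (ℕP.n∸n≡0 r)

  open ArmFactor q t generic legGap legGap-zero (λ d → ℕP.∸-monoʳ-≤ j0 (colAt-step d))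
  open LegFactor q t generic armGap armGap-zero

  extArm-corner : ∀ d e → extArm lam (i ℕ.+ d) (j ℕ.+ e) ≡ d ℕ.+ armGap e
  extArm-corner d e = exterior-gap d (rowAt≤ e)

  extLeg-corner : ∀ d e → extLeg lam (i ℕ.+ d) (j ℕ.+ e) ≡ e ℕ.+ legGap d
  extLeg-corner d e = exterior-gap e (colAt≤ d)

  ArmBelow LegBelow : ℕ → ℕ → ℕ → Set
  ArmBelow n d e = ∀ {d′} → d′ < d → walk lam q t n (i ℕ.+ d′) (j ℕ.+ e) i j ≡ armWeight d′ * legWeight e
  LegBelow n d e = ∀ {e′} → e′ < e → walk lam q t n (i ℕ.+ d) (j ℕ.+ e′) i j ≡ armWeight d * legWeight e′

  module FirstStep (n d e : ℕ) (arm-ih : ArmBelow n d e) (leg-ih : LegBelow n d e) where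

    a l : ℕ
    a = d ℕ.+ armGap e
    l = e ℕ.+ legGap d

    D : ℚ
    D = br q t a l

    armCoeff legCoeff armTerm legTerm : ℕ → ℚ
    armCoeff k = div (pow q (a ∸ k) * pow t l * (1ℚ - q)) D
    legCoeff k = div (pow t (k ∸ 1) * (1ℚ - t)) D
    armTerm k = armCoeff k * walk lam q t n (i ℕ.+ d ∸ k) (j ℕ.+ e) i j
    legTerm k = legCoeff k * walk lam q t n (i ℕ.+ d) (j ℕ.+ e ∸ k) i j

    arm-sum : sum1 a armTerm ≡ pow q (armGap e) * pow t l * inv D * legWeight e * armSeries d
    arm-sum = begin
      sum1 a armTerm
        ≡⟨ sum1-split d (armGap e) armTerm ⟩
      sum1 d armTerm + sum1 (armGap e) (λ k → armTerm (d ℕ.+ k))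
        ≡⟨ cong₂ _+_ (trans (sum1-cong d inside) (sum1-*ˡ d C _)) (sum1-≡0 (armGap e) outside) ⟩
      C * armSeries d + 0ℚ
        ≡⟨ ℚP.+-identityʳ _ ⟩
      C * armSeries d ∎
      where
      open ≡-Reasoning
      open ℚSolver.+-*-Solver
      C = pow q (armGap e) * pow t l * inv D * legWeight e
      inside : ∀ k → 1 ≤ k → k ≤ d → armTerm k ≡ C * (pow q (d ∸ k) * (1ℚ - q) * armWeight (d ∸ k))
      inside k 1≤k k≤d = begin
        armTerm k
          ≡⟨ cong₂ _*_ (div≡*inv _ D)
                       (trans (cong (λ x → walk lam q t n x (j ℕ.+ e) i j) (ℕP.+-∸-assoc i k≤d))
                              (arm-ih (ℕP.∸-monoʳ-< 1≤k k≤d))) ⟩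
        pow q (a ∸ k) * pow t l * (1ℚ - q) * inv D * (armWeight (d ∸ k) * legWeight e)
          ≡⟨ cong (λ z → pow q z * pow t l * (1ℚ - q) * inv D * (armWeight (d ∸ k) * legWeight e))
                  (ℕP.+-∸-comm (armGap e) k≤d) ⟩
        pow q (d ∸ k ℕ.+ armGap e) * pow t l * (1ℚ - q) * inv D * (armWeight (d ∸ k) * legWeight e)
          ≡⟨ cong (λ z → z * pow t l * (1ℚ - q) * inv D * (armWeight (d ∸ k) * legWeight e))
                  (pow-+ q (d ∸ k) (armGap e)) ⟩
        pow q (d ∸ k) * pow q (armGap e) * pow t l * (1ℚ - q) * inv D * (armWeight (d ∸ k) * legWeight e)
          ≡⟨ solve 7 (λ Qk Qp Tl q I G H → Qk :* Qp :* Tl :* (con 1ℚ :- q) :* I :* (G :* H)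
                                      := Qp :* Tl :* I :* H :* (Qk :* (con 1ℚ :- q) :* G)) refl
                   (pow q (d ∸ k)) (pow q (armGap e)) (pow t l) q (inv D) (armWeight (d ∸ k)) (legWeight e) ⟩
        C * (pow q (d ∸ k) * (1ℚ - q) * armWeight (d ∸ k)) ∎
      outside : ∀ k → 1 ≤ k → k ≤ armGap e → armTerm (d ℕ.+ k) ≡ 0ℚ
      outside k 1≤k _ =
        *≡0ʳ (armCoeff (d ℕ.+ k)) (walk-outside lam q t n (inj₁ (subst (_< i) (sym left) (∸-shrinks 1≤k))))
        where
        left : i ℕ.+ d ∸ (d ℕ.+ k) ≡ i ∸ k
        left = trans (cong (_∸ (d ℕ.+ k)) (ℕP.+-comm i d)) (ℕP.[m+n]∸[m+o]≡n∸o d i k)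

    leg-sum : sum1 l legTerm ≡ inv D * armWeight d * legSeries e
    leg-sum = begin
      sum1 l legTerm
        ≡⟨ sum1-split e (legGap d) legTerm ⟩
      sum1 e legTerm + sum1 (legGap d) (λ k → legTerm (e ℕ.+ k))
        ≡⟨ cong₂ _+_ (trans (sum1-cong e inside) (sum1-*ˡ e C _)) (sum1-≡0 (legGap d) outside) ⟩
      C * legSeries e + 0ℚ
        ≡⟨ ℚP.+-identityʳ _ ⟩
      C * legSeries e ∎
      where
      open ≡-Reasoning
      open ℚSolver.+-*-Solver
      C = inv D * armWeight d
      inside : ∀ k → 1 ≤ k → k ≤ e → legTerm k ≡ C * (pow t (k ∸ 1) * (1ℚ - t) * legWeight (e ∸ k))
      inside k 1≤k k≤e = begin
        legTerm k
          ≡⟨ cong₂ _*_ (div≡*inv _ D)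
                       (trans (cong (λ y → walk lam q t n (i ℕ.+ d) y i j) (ℕP.+-∸-assoc j k≤e))
                              (leg-ih (ℕP.∸-monoʳ-< 1≤k k≤e))) ⟩
        pow t (k ∸ 1) * (1ℚ - t) * inv D * (armWeight d * legWeight (e ∸ k))
          ≡⟨ solve 5 (λ Tk t I G H → Tk :* (con 1ℚ :- t) :* I :* (G :* H) := I :* G :* (Tk :* (con 1ℚ :- t) :* H)) refl
                   (pow t (k ∸ 1)) t (inv D) (armWeight d) (legWeight (e ∸ k)) ⟩
        C * (pow t (k ∸ 1) * (1ℚ - t) * legWeight (e ∸ k)) ∎
      outside : ∀ k → 1 ≤ k → k ≤ legGap d → legTerm (e ℕ.+ k) ≡ 0ℚ
      outside k 1≤k _ =
        *≡0ʳ (legCoeff (e ℕ.+ k)) (walk-outside lam q t n (inj₂ (subst (_< j) (sym below) (∸-shrinks 1≤k))))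
        where
        below : j ℕ.+ e ∸ (e ℕ.+ k) ≡ j ∸ k
        below = trans (cong (_∸ (e ℕ.+ k)) (ℕP.+-comm j e)) (ℕP.[m+n]∸[m+o]≡n∸o e j k)

    first-step : d ℕ.+ e ≢ 0 → sum1 a armTerm + sum1 l legTerm ≡ armWeight d * legWeight e
    first-step d+e≢0 = begin
      sum1 a armTerm + sum1 l legTerm
        ≡⟨ cong₂ _+_ arm-sum leg-sum ⟩
      Qp * pow t l * inv D * H * armSeries d + inv D * G * legSeries e
        ≡⟨ cong (λ z → Qp * z * inv D * H * armSeries d + inv D * G * legSeries e) (pow-+ t e (legGap d)) ⟩
      Qp * (Te * Tm) * inv D * H * armSeries d + inv D * G * legSeries e
        ≡⟨ solve 8 (λ Qp Te Tm I H S G L → Qp :* (Te :* Tm) :* I :* H :* S :+ I :* G :* L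
                                      := I :* (Qp :* Te :* H :* (Tm :* S) :+ G :* L)) refl
                 Qp Te Tm (inv D) H (armSeries d) G (legSeries e) ⟩
        inv D * (Qp * Te * H * (Tm * armSeries d) + G * legSeries e)
        ≡⟨ cong₂ (λ u v → inv D * (Qp * Te * H * u + G * v)) (armSeries-closed d) (legSeries-closed e) ⟩
      inv D * (Qp * Te * H * (G * (1ℚ - Qd * Tm)) + G * (H * (1ℚ - Qp * Te)))
        ≡⟨ solve 7 (λ I Qp Te H G Qd Tm →
                      I :* (Qp :* Te :* H :* (G :* (con 1ℚ :- Qd :* Tm)) :+ G :* (H :* (con 1ℚ :- Qp :* Te)))
                   := I :* ((con 1ℚ :- (Qd :* Qp) :* (Te :* Tm)) :* (G :* H))) refl
                 (inv D) Qp Te H G Qd Tm ⟩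
      inv D * ((1ℚ - (Qd * Qp) * (Te * Tm)) * (G * H))
        ≡⟨ cong₂ (λ u v → inv D * ((1ℚ - u * v) * (G * H))) (pow-+ q d (armGap e)) (pow-+ t e (legGap d)) ⟨
      inv D * (D * (G * H))
        ≡⟨ inv-*-cancelˡ D (G * H) D≢0 ⟩
      G * H ∎
      where
      open ≡-Reasoning
      open ℚSolver.+-*-Solver
      Qp = pow q (armGap e)
      Qd = pow q d
      Te = pow t e
      Tm = pow t (legGap d)
      G = armWeight d
      H = legWeight e
      D≢0 : D ≢ 0ℚ
      D≢0 = generic a l λ a+l≡0 → d+e≢0 (cong₂ ℕ._+_ (ℕP.m+n≡0⇒m≡0 d (ℕP.m+n≡0⇒m≡0 a a+l≡0))
                                                     (ℕP.m+n≡0⇒m≡0 e (ℕP.m+n≡0⇒n≡0 a a+l≡0)))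

  walkStep-factorises : ∀ n d e → ArmBelow n d e → LegBelow n d e →
    walkStep lam q t n (i ℕ.+ d) (j ℕ.+ e) i j (d ℕ.+ armGap e) (e ℕ.+ legGap d) ≡ armWeight d * legWeight e
  walkStep-factorises n zero zero _ _ = begin
    walkStep lam q t n (i ℕ.+ 0) (j ℕ.+ 0) i j (armGap 0) (legGap 0)
      ≡⟨ cong₂ (walkStep lam q t n (i ℕ.+ 0) (j ℕ.+ 0) i j) armGap-zero legGap-zero ⟩
    (if eqCell (i ℕ.+ 0) (j ℕ.+ 0) i j then 1ℚ else 0ℚ)
      ≡⟨ cong (if_then 1ℚ else 0ℚ) (trans (cong₂ (λ x y → eqCell x y i j) (ℕP.+-identityʳ i) (ℕP.+-identityʳ j))
                                          (eqCell-refl i j)) ⟩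
    1ℚ
      ≡⟨ cong (λ m → pow t m * 1ℚ * 1ℚ) legGap-zero ⟨
    armWeight 0 * legWeight 0 ∎
    where open ≡-Reasoning
  walkStep-factorises n (suc d) e arm-ih leg-ih = FirstStep.first-step n (suc d) e arm-ih leg-ih (λ ())
  walkStep-factorises n zero (suc e) arm-ih leg-ih =
    trans (if-false {u = if eqCell (i ℕ.+ 0) (j ℕ.+ suc e) i j then 1ℚ else 0ℚ} (BoolP.∧-zeroʳ (isZero (armGap (suc e)))))
          (FirstStep.first-step n zero (suc e) arm-ih leg-ih (λ ()))

  walk-factorises : ∀ n d e → i ℕ.+ d ℕ.+ (j ℕ.+ e) ≤ n →
    walk lam q t n (i ℕ.+ d) (j ℕ.+ e) i j ≡ armWeight d * legWeight e
  walk-factorises (suc n) d e bound =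
    trans (cong₂ (walkStep lam q t n (i ℕ.+ d) (j ℕ.+ e) i j) (extArm-corner d e) (extLeg-corner d e))
          (walkStep-factorises n d e arm-ih leg-ih)
    where
    arm-ih : ArmBelow n d e
    arm-ih d′<d = walk-factorises n _ e
      (ℕP.≤-pred (ℕP.≤-trans (ℕP.+-monoˡ-< (j ℕ.+ e) (ℕP.+-monoʳ-< i d′<d)) bound))
    leg-ih : LegBelow n d e
    leg-ih e′<e = walk-factorises n d _
      (ℕP.≤-pred (ℕP.≤-trans (ℕP.+-monoʳ-< (i ℕ.+ d) (ℕP.+-monoʳ-< j e′<e)) bound))

  armProduct-closed : ∀ d → armProduct d ≡ prodOver (colAt d) j0 (colFactor lam q t i)
  armProduct-closed zero = sym (trans (cong (λ c → prodOver c j0 (colFactor lam q t i)) colAt≡j0)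
                                     (prodOver-empty j0 (colFactor lam q t i)))
    where
    colAt≡j0 : colAt 0 ≡ j0
    colAt≡j0 = trans (cong (col lam) (ℕP.+-identityʳ i)) col-corner
  armProduct-closed (suc d) = begin
    armProduct d * div (ψ c) (ψ c′)
      ≡⟨ cong (_* div (ψ c) (ψ c′)) (armProduct-closed d) ⟩
    prodOver c j0 F * div (ψ c) (ψ c′)
      ≡⟨ ℚP.*-comm (prodOver c j0 F) (div (ψ c) (ψ c′)) ⟩
    div (ψ c) (ψ c′) * prodOver c j0 F
      ≡⟨ prodOver-peel F ψ (λ z → br-suc≢0ˡ generic d (j0 ∸ z)) (colAt-step d) (colAt≤ d) factor ⟨
    prodOver c′ j0 F ∎
    where
    open ≡-Reasoning
    F = colFactor lam q t i
    c = colAt d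
    c′ = colAt (suc d)
    ψ : ℕ → ℚ
    ψ y = br q t (suc d) (j0 ∸ y)
    factor : ∀ y → c′ < y → y ≤ c → F y ≡ div (ψ y) (ψ (pred y))
    factor y c′<y y≤c = trans (cong₂ (λ a ℓ → div (br q t (suc a) ℓ) (br q t (suc a) (suc ℓ))) arm leg)
                              (cong (λ ℓ → div (ψ y) (br q t (suc d) ℓ)) (sym pred-leg))
      where
      1≤y = ℕP.≤-trans (s≤s z≤n) c′<y
      pred-leg : j0 ∸ pred y ≡ suc (j0 ∸ y)
      pred-leg = ∸-pred 1≤y (ℕP.≤-trans y≤c (colAt≤ d))
      arm : armIn lam i y ≡ d
      arm = trans (cong (_∸ i) (row-between lam lam-dec (s≤s z≤n) 1≤y c′<y′ y≤c)) (ℕP.m+n∸m≡n i d)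
        where c′<y′ = subst (λ z → col lam z < y) (ℕP.+-suc i d) c′<y
      leg : legIn lam i y ≡ j0 ∸ y
      leg = cong (_∸ y) col-corner

  legWeight-closed : ∀ e → legWeight e ≡ prodOver (rowAt e) r (rowFactor lam q t j)
  legWeight-closed zero = sym (trans (cong (λ u → prodOver (row lam u) r (rowFactor lam q t j)) (ℕP.+-identityʳ j))
                                    (prodOver-empty r (rowFactor lam q t j)))
  legWeight-closed (suc e) = begin
    legWeight e * div (ψ u) (ψ u′)
      ≡⟨ cong (_* div (ψ u) (ψ u′)) (legWeight-closed e) ⟩
    prodOver u r F * div (ψ u) (ψ u′)
      ≡⟨ ℚP.*-comm (prodOver u r F) (div (ψ u) (ψ u′)) ⟩
    div (ψ u) (ψ u′) * prodOver u r F
      ≡⟨ prodOver-peel F ψ (λ z → br-suc≢0ʳ generic (r ∸ z) e) (rowAt-step e) (rowAt≤ e) factor ⟨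
    prodOver u′ r F ∎
    where
    open ≡-Reasoning
    F = rowFactor lam q t j
    u = rowAt e
    u′ = rowAt (suc e)
    ψ : ℕ → ℚ
    ψ x = br q t (r ∸ x) (suc e)
    factor : ∀ x → u′ < x → x ≤ u → F x ≡ div (ψ x) (ψ (pred x))
    factor x u′<x x≤u = trans (cong (λ ℓ → div (br q t (r ∸ x) (suc ℓ)) (br q t (suc (r ∸ x)) (suc ℓ))) leg)
                              (cong (λ a → div (ψ x) (br q t a (suc e))) (sym pred-arm))
      where
      1≤x = ℕP.≤-trans (s≤s z≤n) u′<x
      pred-arm : r ∸ pred x ≡ suc (r ∸ x)
      pred-arm = ∸-pred 1≤x (ℕP.≤-trans x≤u (rowAt≤ e))
      leg : legIn lam x j ≡ e
      leg = trans (cong (_∸ j) (col-between lam lam-dec 1≤x (s≤s z≤n) u′<x′ x≤u)) (ℕP.m+n∸m≡n j e)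
        where u′<x′ = subst (λ z → row lam z < x) (ℕP.+-suc j e) u′<x

  armWeight-far : ∀ {d} → colAt d ≡ 0 → armWeight d ≡ pow t j0 * prod1 j0 (colFactor lam q t i)
  armWeight-far {d} colAt≡0 = cong₂ (λ c P → pow t (j0 ∸ c) * P) colAt≡0
    (trans (armProduct-closed d) (cong (λ c → prodOver c j0 (colFactor lam q t i)) colAt≡0))

  legWeight-far : ∀ {e} → rowAt e ≡ 0 → legWeight e ≡ prod1 r (rowFactor lam q t j)
  legWeight-far {e} rowAt≡0 = trans (legWeight-closed e) (cong (λ u → prodOver u r (rowFactor lam q t j)) rowAt≡0)

  hookProb-far : ∀ {x y} → row lam 1 < x → col lam 1 < y →
    hookProb lam q t x y i j ≡ pow t j0 * (prod1 r (rowFactor lam q t j) * prod1 j0 (colFactor lam q t i))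
  hookProb-far {x} {y} row<x col<y = begin
    walk lam q t (x ℕ.+ y) x y i j
      ≡⟨ cong₂ (λ x y → walk lam q t (x ℕ.+ y) x y i j) i+dX≡x j+eY≡y ⟨
    walk lam q t (i ℕ.+ dX ℕ.+ (j ℕ.+ eY)) (i ℕ.+ dX) (j ℕ.+ eY) i j
      ≡⟨ walk-factorises _ dX eY ℕP.≤-refl ⟩
    armWeight dX * legWeight eY
      ≡⟨ cong₂ _*_ (armWeight-far colAt≡0) (legWeight-far rowAt≡0) ⟩
    pow t j0 * CF * RF
      ≡⟨ ℚP.*-assoc (pow t j0) CF RF ⟩
    pow t j0 * (CF * RF)
      ≡⟨ cong (pow t j0 *_) (ℚP.*-comm CF RF) ⟩
    pow t j0 * (RF * CF) ∎
    where
    open ≡-Reasoning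
    CF = prod1 j0 (colFactor lam q t i)
    RF = prod1 r (rowFactor lam q t j)
    dX = x ∸ i
    eY = y ∸ j
    i+dX≡x : i ℕ.+ dX ≡ x
    i+dX≡x = ℕP.m+[n∸m]≡n (ℕP.≤-<-trans (row-antitone lam lam-dec (s≤s z≤n) (s≤s z≤n)) row<x)
    j+eY≡y : j ℕ.+ eY ≡ y
    j+eY≡y = ℕP.m+[n∸m]≡n (ℕP.≤-<-trans j0≤col col<y)
      where j0≤col = subst (_≤ col lam 1) col-corner (col-antitone lam lam-dec (s≤s z≤n) (s≤s z≤n))
    colAt≡0 : colAt dX ≡ 0
    colAt≡0 = trans (cong (col lam) i+dX≡x) (col≡0 lam lam-dec row<x)
    rowAt≡0 : rowAt eY ≡ 0
    rowAt≡0 = trans (cong (row lam) j+eY≡y) (row≡0 lam lam-dec (ℕP.≤-trans (s≤s z≤n) col<y) col<y)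

theorem6p5 : (lam nu : List ℕ) → IsPartition lam → IsPartition nu →
    (i j : ℕ) → AddsCell lam nu i j →
    (x y : ℕ) → x > row lam 1 → y > col lam 1 →
    (q t : ℚ) → Generic q t →
    hookProb lam q t x y i j
      ≡ pow t (nFun nu ∸ nFun lam) * alpha lam nu i j q t
theorem6p5 lam nu (_ , lam-dec) (_ , nu-dec) .(row nu (suc j0)) (suc j0) (s≤s z≤n , nu-row , refl , nu-other)
           x y row<x col<y q t generic =
  subst (λ i → hookProb lam q t x y i j ≡ pow t (nFun nu ∸ nFun lam) * alpha lam nu i j q t) (sym nu-row) (begin
    hookProb lam q t x y i j
      ≡⟨ CornerWalk.hookProb-far lam lam-dec j0 col-corner q t generic row<x col<y ⟩
    pow t j0 * (prod1 r (rowFactor lam q t j) * prod1 j0 (colFactor lam q t i))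
      ≡⟨ cong₂ (λ k α → pow t k * α) n-added (alpha-corner q t) ⟨
    pow t (nFun nu ∸ nFun lam) * alpha lam nu i j q t ∎)
  where
  open AddedCell lam nu lam-dec nu-dec j0 nu-row nu-other
  open ≡-Reasoning
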